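{- Let $G$ be a graph and let $\mathcal{I}=\{[\ell_v,r_v]: v\in V(G)\}$ be an interval representation of $G$. Then there is a tidy interval representation $\mathcal{I}'=\{[\ell'_v,r'_v]: v\in V(G)\}$ of $G$ such that $[\ell'_v,r'_v]\subseteq[\ell_v,r_v]$ for all $v\in V(G)$. Furthermore, every compact interval representation of $G$ is tidy.
   Context: An interval representation of a graph $G$ is a family $\{[\ell_v,r_v]: v\in V(G)\}$ of closed real intervals such that distinct $u,v$ are adjacent iff $[\ell_u,r_u]\cap[\ell_v,r_v]\neq\emptyset$. It is compact if $|\{\ell_v: v\in V(G)\}\cup\{r_v: v\in V(G)\}|$ is minimal among all interval representations of $G$. For $v\in V(G)$, $N_G[v]$ is the closed neighborhood, and for $M\subseteq V(G)$, $N_G[M]=\bigcup_{m\in M}N_G[m]$. The representation is tidy if for every $v\in V(G)$ and every $M\subseteq V(G)$ with $N_G[v]\subseteq N_G[M]$ we have $[\ell_v,r_v]\subseteq[\min_{m\in M}\ell_m,\max_{m\in M}r_m]$.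
   Formalization: Interval endpoints are rational instead of real, so compactness minimises the number of distinct endpoints only over representations with rational endpoints. -}

module Defs where

open import Level using (0ℓ)
open import Data.Nat using (ℕ)
open import Data.Fin using (Fin)
open import Data.Fin.Subset using (Subset; _∈_)
open import Data.List using (List; map; _++_; length; deduplicate; allFin)
open import Data.Rational using (ℚ; _≤_; _≟_)
open import Data.Product using (_×_; Σ-syntax)
open import Data.Sum using (_⊎_)
open import Relation.Nullary using (¬_)
open import Relation.Binary.PropositionalEquality using (_≡_)

record Graph (n : ℕ) : Set₁ where
  field
    Adj      : Fin n → Fin n → Set
    sym      : ∀ {u v} → Adj u v → Adj v u
    irrefl   : ∀ {v} → ¬ Adj v v
open Graph public

record Intervals (n : ℕ) : Set where
  field
    ℓ : Fin n → ℚ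
    r : Fin n → ℚ
open Intervals public

IsIntervalRep : ∀ {n} → Graph n → Intervals n → Set
IsIntervalRep {n} G I =
  (∀ v → ℓ I v ≤ r I v) ×
  (∀ (u v : Fin n) → ¬ (u ≡ v) →
     (Adj G u v → (ℓ I u ≤ r I v × ℓ I v ≤ r I u)) ×
     ((ℓ I u ≤ r I v × ℓ I v ≤ r I u) → Adj G u v))

endpointCount : ∀ {n} → Intervals n → ℕ
endpointCount {n} I =
  length (deduplicate _≟_ (map (ℓ I) (allFin n) ++ map (r I) (allFin n)))

IsCompact : ∀ {n} → Graph n → Intervals n → Set
IsCompact G I = IsIntervalRep G I ×
  (∀ J → IsIntervalRep G J → endpointCount I Data.Nat.≤ endpointCount J)

N[_]_∋_ : ∀ {n} → Graph n → Fin n → Fin n → Set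
N[ G ] v ∋ w = (w ≡ v) ⊎ Adj G v w

NM[_]_∋_ : ∀ {n} → Graph n → Subset n → Fin n → Set
NM[_]_∋_ {n} G M w = Σ[ m ∈ Fin n ] (m ∈ M × N[ G ] m ∋ w)

-- Tidy: whenever N[v] ⊆ N[M], [ℓ v, r v] ⊆ [min_{m∈M} ℓ m, max_{m∈M} r m]
-- (min/max over M written out: some m ∈ M has ℓ m ≤ ℓ v, some m' ∈ M has r v ≤ r m').
IsTidy : ∀ {n} → Graph n → Intervals n → Set
IsTidy {n} G I = IsIntervalRep G I ×
  (∀ (v : Fin n) (M : Subset n) →
     (∀ w → N[ G ] v ∋ w → NM[ G ] M ∋ w) →
     (Σ[ m ∈ Fin n ] (m ∈ M × ℓ I m ≤ ℓ I v)) ×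
     (Σ[ m ∈ Fin n ] (m ∈ M × r I v ≤ r I m)))

_⊆ᴵ_ : ∀ {n} → Intervals n → Intervals n → Set
J ⊆ᴵ I = ∀ v → (ℓ I v ≤ ℓ J v) × (r J v ≤ r I v)

{-# OPTIONS --safe #-}
-- If some left endpoint p is not a right endpoint, replace every left endpoint equal to p
-- by the least right endpoint q ≥ p.  No comparison ℓ u ≤ r w changes, so this is a
-- representation of the same graph inside the old one, with fewer distinct endpoints;
-- right endpoints are treated the same way after reflecting the line.  Iterating ends in a
-- representation where every left endpoint is a right endpoint and vice versa, and such a
-- representation is tidy: if N[v] ⊆ N[M] and ℓ v = r x, then x ∈ N[v], so some m ∈ M has
-- x ∈ N[m], hence ℓ m ≤ r x = ℓ v.  A compact representation admits no reduction step.
module Submission where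

open import Defs
open import Data.Nat using (ℕ)
open import Data.Product using (_×_; Σ-syntax)

open import Algebra.Properties.Group using (⁻¹-involutive)
open import Data.Fin using (Fin)
open import Data.Fin.Properties using (any?; all?; ¬∀⟶∃¬) renaming (_≟_ to _≟ᶠ_)
open import Data.Fin.Subset using () renaming (_∈_ to _∈ₛ_)
open import Data.List using (List; _∷_; map; _++_; length; filter; deduplicate; allFin)
open import Data.List.Membership.Propositional using (_∈_; _∉_)
open import Data.List.Membership.Propositional.Properties
  using (∈-map⁺; ∈-map⁻; ∈-++⁺ˡ; ∈-++⁺ʳ; ∈-++⁻; ∈-allFin; ∈-filter⁺; ∈-deduplicate⁺; ∈-deduplicate⁻)
open import Data.List.Properties using (length-map; filter-notAll)
open import Data.List.Relation.Binary.Subset.Propositional using (_⊆_)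
open import Data.List.Relation.Binary.Subset.Propositional.Properties using (⊆-trans; map⁺; ∈-∷⁺ʳ)
open import Data.List.Relation.Unary.All as All using ()
open import Data.List.Relation.Unary.All.Properties using (all-filter)
open import Data.List.Relation.Unary.AllPairs using ([]; _∷_)
open import Data.List.Relation.Unary.Any as Any using (here; there)
open import Data.List.Relation.Unary.Unique.Propositional using (Unique)
open import Data.List.Relation.Unary.Unique.DecPropositional.Properties using (deduplicate-!)
import Data.Nat as ℕ
import Data.Nat.Properties as ℕ
open import Data.Nat.Induction using (<-wellFounded)
open import Data.Product using (_,_; proj₁; proj₂; map₂)
open import Data.Product.Function.NonDependent.Propositional using (_×-⇔_)
open import Data.Rational using (ℚ; _≤_; _≟_; -_)
open import Data.Rational.Properties
  using (≤-refl; ≤-trans; ≤-reflexive; _≤?_; neg-antimono-≤; neg-injective; ≤-decTotalOrder; +-0-group)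
open import Data.Sum using (_⊎_; inj₁; inj₂)
open import Function using (_∘_; _on_)
open import Function.Bundles using (_⇔_; mk⇔; Equivalence)
open import Induction.WellFounded using (Acc; acc)
open import Relation.Binary.Bundles using (DecTotalOrder)
open import Relation.Binary.Construct.On as On using ()
open import Relation.Binary.Definitions using (DecidableEquality)
open import Relation.Binary.PropositionalEquality as ≡ using (_≡_; _≢_; refl; cong; subst; subst₂)
open import Relation.Nullary using (yes; no; ¬?; contradiction)

open import Data.List.Extrema (DecTotalOrder.totalOrder ≤-decTotalOrder)
  using (argmin; v≤f[argmin]⁺; f[argmin]≤f[xs])
open Equivalence using (to; from)

module _ {A : Set} (_≟ₐ_ : DecidableEquality A) where

  unique-⊆⇒length≤ : ∀ {xs ys : List A} → Unique xs → xs ⊆ ys → length xs ℕ.≤ length ys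
  unique-⊆⇒length≤ [] _ = ℕ.z≤n
  unique-⊆⇒length≤ {x ∷ xs} {ys} (x∉xs ∷ xs!) x∷xs⊆ys =
    ℕ.≤-<-trans (unique-⊆⇒length≤ xs! xs⊆ys∖x)
                (filter-notAll (¬? ∘ (x ≟ₐ_)) ys (Any.map (λ x≡y x≢y → x≢y x≡y) (x∷xs⊆ys (here refl))))
    where
    xs⊆ys∖x : xs ⊆ filter (¬? ∘ (x ≟ₐ_)) ys
    xs⊆ys∖x z∈xs = ∈-filter⁺ (¬? ∘ (x ≟ₐ_)) (x∷xs⊆ys (there z∈xs)) (All.lookup x∉xs z∈xs)

  private
    dedup : List A → List A
    dedup = deduplicate _≟ₐ_

  length-deduplicate-⊆-map : ∀ (f : A → A) {xs ys} → xs ⊆ map f ys →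
                             length (dedup xs) ℕ.≤ length (dedup ys)
  length-deduplicate-⊆-map f {xs} {ys} xs⊆fys =
    ℕ.≤-trans (unique-⊆⇒length≤ (deduplicate-! _≟ₐ_ xs) dedup-xs⊆fdedup-ys)
              (ℕ.≤-reflexive (length-map f (dedup ys)))
    where
    dedup-xs⊆fdedup-ys : dedup xs ⊆ map f (dedup ys)
    dedup-xs⊆fdedup-ys = ⊆-trans (∈-deduplicate⁻ _≟ₐ_ xs) (⊆-trans xs⊆fys (map⁺ f (∈-deduplicate⁺ _≟ₐ_)))

  length-deduplicate-⊂ : ∀ {xs ys y} → xs ⊆ ys → y ∈ ys → y ∉ xs →
                         length (dedup xs) ℕ.< length (dedup ys)
  length-deduplicate-⊂ {xs} {ys} {y} xs⊆ys y∈ys y∉xs =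
    unique-⊆⇒length≤ (All.tabulate y≢dedup-xs ∷ deduplicate-! _≟ₐ_ xs)
      (∈-∷⁺ʳ (∈-deduplicate⁺ _≟ₐ_ y∈ys)
             (⊆-trans (∈-deduplicate⁻ _≟ₐ_ xs) (⊆-trans xs⊆ys (∈-deduplicate⁺ _≟ₐ_))))
    where
    y≢dedup-xs : ∀ {z} → z ∈ dedup xs → y ≢ z
    y≢dedup-xs z∈ refl = y∉xs (∈-deduplicate⁻ _≟ₐ_ xs z∈)

neg-involutive : ∀ p → - - p ≡ p
neg-involutive = ⁻¹-involutive +-0-group

neg-cancel-≤ : ∀ {p q} → - p ≤ - q → q ≤ p
neg-cancel-≤ {p} {q} h = subst₂ _≤_ (neg-involutive q) (neg-involutive p) (neg-antimono-≤ h)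

neg-swapˡ-≤ : ∀ {p q} → - p ≤ q → - q ≤ p
neg-swapˡ-≤ {p} h = subst (_ ≤_) (neg-involutive p) (neg-antimono-≤ h)

neg-swapʳ-≤ : ∀ {p q} → p ≤ - q → q ≤ - p
neg-swapʳ-≤ {q = q} h = subst (_≤ _) (neg-involutive q) (neg-antimono-≤ h)

module _ {n : ℕ} where

  Meets : Intervals n → Fin n → Fin n → Set
  Meets I u v = ℓ I u ≤ r I v × ℓ I v ≤ r I u

  EveryLeftEndpointIsRight : Intervals n → Set
  EveryLeftEndpointIsRight I = ∀ v → Σ[ x ∈ Fin n ] r I x ≡ ℓ I v

  EveryRightEndpointIsLeft : Intervals n → Set
  EveryRightEndpointIsLeft I = ∀ v → Σ[ x ∈ Fin n ] ℓ I x ≡ r I v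

  ⊆ᴵ-refl : ∀ {I : Intervals n} → I ⊆ᴵ I
  ⊆ᴵ-refl v = ≤-refl , ≤-refl

  ⊆ᴵ-trans : ∀ {I J K : Intervals n} → K ⊆ᴵ J → J ⊆ᴵ I → K ⊆ᴵ I
  ⊆ᴵ-trans K⊆J J⊆I v = ≤-trans (proj₁ (J⊆I v)) (proj₁ (K⊆J v)) , ≤-trans (proj₂ (K⊆J v)) (proj₂ (J⊆I v))

  reflect : Intervals n → Intervals n
  reflect I = record { ℓ = λ v → - r I v ; r = λ v → - ℓ I v }

  Meets-reflect : ∀ {I u v} → Meets I u v ⇔ Meets (reflect I) u v
  Meets-reflect = mk⇔ (λ (ℓu≤rv , ℓv≤ru) → neg-antimono-≤ ℓv≤ru , neg-antimono-≤ ℓu≤rv)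
                      (λ (ℓ′u≤r′v , ℓ′v≤r′u) → neg-cancel-≤ ℓ′v≤r′u , neg-cancel-≤ ℓ′u≤r′v)

  reflect-⊆ᴵ : ∀ {I J} → J ⊆ᴵ reflect I → reflect J ⊆ᴵ I
  reflect-⊆ᴵ J⊆I′ v = neg-swapʳ-≤ (proj₂ (J⊆I′ v)) , neg-swapˡ-≤ (proj₁ (J⊆I′ v))

  endpoints : Intervals n → List ℚ
  endpoints I = map (ℓ I) (allFin n) ++ map (r I) (allFin n)

  ℓ∈endpoints : ∀ I v → ℓ I v ∈ endpoints I
  ℓ∈endpoints I v = ∈-++⁺ˡ (∈-map⁺ (ℓ I) (∈-allFin v))

  r∈endpoints : ∀ I v → r I v ∈ endpoints I
  r∈endpoints I v = ∈-++⁺ʳ (map (ℓ I) (allFin n)) (∈-map⁺ (r I) (∈-allFin v))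

  ∈-endpoints⁻ : ∀ I {a} → a ∈ endpoints I → (Σ[ v ∈ Fin n ] a ≡ ℓ I v) ⊎ (Σ[ v ∈ Fin n ] a ≡ r I v)
  ∈-endpoints⁻ I a∈ with ∈-++⁻ (map (ℓ I) (allFin n)) a∈
  ... | inj₁ a∈ℓs = let v , _ , a≡ℓv = ∈-map⁻ (ℓ I) a∈ℓs in inj₁ (v , a≡ℓv)
  ... | inj₂ a∈rs = let v , _ , a≡rv = ∈-map⁻ (r I) a∈rs in inj₂ (v , a≡rv)

  endpointCount-⊂ : ∀ {I J p} → endpoints J ⊆ endpoints I → p ∈ endpoints I → p ∉ endpoints J →
                    endpointCount J ℕ.< endpointCount I
  endpointCount-⊂ = length-deduplicate-⊂ _≟_

  endpointCount-reflect : ∀ I → endpointCount (reflect I) ℕ.≤ endpointCount I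
  endpointCount-reflect I = length-deduplicate-⊆-map _≟_ -_ negated
    where
    negated : endpoints (reflect I) ⊆ map -_ (endpoints I)
    negated a∈ with ∈-endpoints⁻ (reflect I) a∈
    ... | inj₁ (v , refl) = ∈-map⁺ -_ (r∈endpoints I v)
    ... | inj₂ (v , refl) = ∈-map⁺ -_ (ℓ∈endpoints I v)

module _ {n : ℕ} (G : Graph n) where

  IsIntervalRep-resp-Meets : ∀ {I J} → (∀ u v → Meets I u v ⇔ Meets J u v) →
                             IsIntervalRep G I → IsIntervalRep G J
  IsIntervalRep-resp-Meets I⇔J (ℓ≤r , adj⇔meets) =
    (λ v → proj₁ (to (I⇔J v v) (ℓ≤r v , ℓ≤r v))) ,
    λ u v u≢v → to (I⇔J u v) ∘ proj₁ (adj⇔meets u v u≢v) , proj₂ (adj⇔meets u v u≢v) ∘ from (I⇔J u v)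

  reflect-rep : ∀ {I} → IsIntervalRep G I → IsIntervalRep G (reflect I)
  reflect-rep {I} = IsIntervalRep-resp-Meets (λ u v → Meets-reflect {I = I})

  closedNbr⇒meets : ∀ {I u v} → IsIntervalRep G I → N[ G ] u ∋ v → Meets I u v
  closedNbr⇒meets (ℓ≤r , _) (inj₁ refl) = ℓ≤r _ , ℓ≤r _
  closedNbr⇒meets {u = u} {v} (_ , adj⇔meets) (inj₂ uv) with u ≟ᶠ v
  ... | yes refl = contradiction uv (irrefl G)
  ... | no u≢v = proj₁ (adj⇔meets u v u≢v) uv

  meets⇒closedNbr : ∀ {I u v} → IsIntervalRep G I → Meets I u v → N[ G ] u ∋ v
  meets⇒closedNbr {u = u} {v} (_ , adj⇔meets) uv with v ≟ᶠ u
  ... | yes v≡u = inj₁ v≡u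
  ... | no v≢u = inj₂ (proj₂ (adj⇔meets u v (v≢u ∘ ≡.sym)) uv)

  leftTidy : ∀ {I} → IsIntervalRep G I → EveryLeftEndpointIsRight I →
             ∀ v M → (∀ w → N[ G ] v ∋ w → NM[ G ] M ∋ w) → Σ[ m ∈ Fin n ] (m ∈ₛ M × ℓ I m ≤ ℓ I v)
  leftTidy rep@(ℓ≤r , _) leftIsRight v M N[v]⊆N[M] =
    let x , rx≡ℓv = leftIsRight v
        v-meets-x = ≤-reflexive (≡.sym rx≡ℓv) , ≤-trans (ℓ≤r x) (≤-trans (≤-reflexive rx≡ℓv) (ℓ≤r v))
        m , m∈M , x∈N[m] = N[v]⊆N[M] x (meets⇒closedNbr rep v-meets-x)
    in m , m∈M , ≤-trans (proj₁ (closedNbr⇒meets rep x∈N[m])) (≤-reflexive rx≡ℓv)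

  rightTidy : ∀ {I} → IsIntervalRep G I → EveryRightEndpointIsLeft I →
              ∀ v M → (∀ w → N[ G ] v ∋ w → NM[ G ] M ∋ w) → Σ[ m ∈ Fin n ] (m ∈ₛ M × r I v ≤ r I m)
  rightTidy rep rightIsLeft v M N[v]⊆N[M] =
    let m , m∈M , -rm≤-rv = leftTidy (reflect-rep rep) (map₂ (cong -_) ∘ rightIsLeft) v M N[v]⊆N[M]
    in m , m∈M , neg-cancel-≤ -rm≤-rv

  shared⇒tidy : ∀ {I} → IsIntervalRep G I → EveryLeftEndpointIsRight I → EveryRightEndpointIsLeft I →
                IsTidy G I
  shared⇒tidy rep leftIsRight rightIsLeft =
    rep , λ v M N[v]⊆N[M] → leftTidy rep leftIsRight v M N[v]⊆N[M] , rightTidy rep rightIsLeft v M N[v]⊆N[M]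

  Shrinking : Intervals n → Set
  Shrinking I = Σ[ J ∈ Intervals n ] (IsIntervalRep G J × J ⊆ᴵ I × endpointCount J ℕ.< endpointCount I)

  Shrinking-reflect : ∀ {I} → Shrinking (reflect I) → Shrinking I
  Shrinking-reflect {I} (J , repJ , J⊆I′ , J<I′) =
    reflect J , reflect-rep repJ , reflect-⊆ᴵ J⊆I′ ,
    ℕ.≤-<-trans (endpointCount-reflect J) (ℕ.<-≤-trans J<I′ (endpointCount-reflect I))

  module RaiseLeftEndpoint (I : Intervals n) (rep : IsIntervalRep G I)
                           (v₀ : Fin n) (notRight : ∀ x → r I x ≢ ℓ I v₀) where

    p : ℚ
    p = ℓ I v₀

    x₀ : Fin n
    x₀ = argmin (r I) v₀ (filter (λ x → p ≤? r I x) (allFin n))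

    q : ℚ
    q = r I x₀

    p≤q : p ≤ q
    p≤q = v≤f[argmin]⁺ (proj₁ rep v₀) (all-filter (λ x → p ≤? r I x) (allFin n))

    q-least : ∀ {y} → p ≤ r I y → q ≤ r I y
    q-least p≤ry =
      All.lookup (f[argmin]≤f[xs] v₀ _) (∈-filter⁺ (λ x → p ≤? r I x) (∈-allFin _) p≤ry)

    raise : ℚ → ℚ
    raise a with a ≟ p
    ... | yes _ = q
    ... | no _ = a

    ≤-raise : ∀ a → a ≤ raise a
    ≤-raise a with a ≟ p
    ... | yes refl = p≤q
    ... | no _ = ≤-refl

    raise-≤-r : ∀ a y → a ≤ r I y ⇔ raise a ≤ r I y
    raise-≤-r a y with a ≟ p
    ... | yes refl = mk⇔ q-least (≤-trans p≤q)
    ... | no _ = mk⇔ (λ h → h) (λ h → h)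

    raise≢p : ∀ a → raise a ≢ p
    raise≢p a with a ≟ p
    ... | yes _ = notRight x₀
    ... | no a≢p = a≢p

    raise-ℓ∈endpoints : ∀ v → raise (ℓ I v) ∈ endpoints I
    raise-ℓ∈endpoints v with ℓ I v ≟ p
    ... | yes _ = r∈endpoints I x₀
    ... | no _ = ℓ∈endpoints I v

    J : Intervals n
    J = record { ℓ = raise ∘ ℓ I ; r = r I }

    endpoints-J⊆I : endpoints J ⊆ endpoints I
    endpoints-J⊆I a∈ with ∈-endpoints⁻ J a∈
    ... | inj₁ (v , refl) = raise-ℓ∈endpoints v
    ... | inj₂ (v , refl) = r∈endpoints I v

    p∉endpoints-J : p ∉ endpoints J
    p∉endpoints-J p∈ with ∈-endpoints⁻ J p∈
    ... | inj₁ (v , p≡ℓ′v) = raise≢p (ℓ I v) (≡.sym p≡ℓ′v)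
    ... | inj₂ (v , p≡rv) = notRight v (≡.sym p≡rv)

    shrinking : Shrinking I
    shrinking =
      J ,
      IsIntervalRep-resp-Meets (λ u v → raise-≤-r (ℓ I u) v ×-⇔ raise-≤-r (ℓ I v) u) rep ,
      (λ v → ≤-raise (ℓ I v) , ≤-refl) ,
      endpointCount-⊂ {I = I} {J = J} endpoints-J⊆I (ℓ∈endpoints I v₀) p∉endpoints-J

  shrinking-or-leftIsRight : ∀ {I} → IsIntervalRep G I → Shrinking I ⊎ EveryLeftEndpointIsRight I
  shrinking-or-leftIsRight {I} rep with all? (λ v → any? (λ x → r I x ≟ ℓ I v))
  ... | yes leftIsRight = inj₂ leftIsRight
  ... | no ¬leftIsRight =
    let v , ¬isRight = ¬∀⟶∃¬ n _ (λ v → any? (λ x → r I x ≟ ℓ I v)) ¬leftIsRight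
    in inj₁ (RaiseLeftEndpoint.shrinking I rep v (λ x rx≡ℓv → ¬isRight (x , rx≡ℓv)))

  shrinking-or-shared : ∀ {I} → IsIntervalRep G I →
                        Shrinking I ⊎ (EveryLeftEndpointIsRight I × EveryRightEndpointIsLeft I)
  shrinking-or-shared rep with shrinking-or-leftIsRight rep | shrinking-or-leftIsRight (reflect-rep rep)
  ... | inj₁ shrinking | _ = inj₁ shrinking
  ... | inj₂ _ | inj₁ shrinking = inj₁ (Shrinking-reflect shrinking)
  ... | inj₂ leftIsRight | inj₂ reflectedLeftIsRight =
    inj₂ (leftIsRight , map₂ neg-injective ∘ reflectedLeftIsRight)

  tidy-within : ∀ I → IsIntervalRep G I → Acc (ℕ._<_ on endpointCount) I →
                Σ[ J ∈ Intervals n ] (IsTidy G J × J ⊆ᴵ I)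
  tidy-within I rep (acc smaller) with shrinking-or-shared rep
  ... | inj₂ (leftIsRight , rightIsLeft) = I , shared⇒tidy rep leftIsRight rightIsLeft , ⊆ᴵ-refl
  ... | inj₁ (J , repJ , J⊆I , J<I) =
    let K , tidyK , K⊆J = tidy-within J repJ (smaller J<I)
    in K , tidyK , ⊆ᴵ-trans K⊆J J⊆I

  compact⇒tidy : ∀ I → IsCompact G I → IsTidy G I
  compact⇒tidy I (rep , minimal) with shrinking-or-shared rep
  ... | inj₂ (leftIsRight , rightIsLeft) = shared⇒tidy rep leftIsRight rightIsLeft
  ... | inj₁ (J , repJ , _ , J<I) = contradiction (minimal J repJ) (ℕ.<⇒≱ J<I)

lemma8 : ∀ (n : ℕ) (G : Graph n) →
    (∀ (I : Intervals n) → IsIntervalRep G I →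
       Σ[ J ∈ Intervals n ] (IsTidy G J × J ⊆ᴵ I)) ×
    (∀ (I : Intervals n) → IsCompact G I → IsTidy G I)
lemma8 n G =
  (λ I rep → tidy-within G I rep (On.wellFounded endpointCount <-wellFounded I)) ,
  compact⇒tidy G
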